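{- Let $k$, $n$ and $s$ be positive integers and let $x_1,\ldots,x_n$ be independent variables; write $E_j^{(s)}=E_j^{(s)}(x_1,\ldots,x_n)$, $H_j^{(s)}=H_j^{(s)}(x_1,\ldots,x_n)$, $P_j^{(s)}=P_j^{(s)}(x_1,\ldots,x_n)$. Then \begin{enumerate} \item $kE_k^{(s)}=\sum_{j=1}^k(-1)^{j-1}P_j^{(s)}E_{k-j}^{(s)}$; \item $kH_k^{(s)}=\sum_{j=1}^k P_j^{(s)}H_{k-j}^{(s)}$; \item $P_k^{(s)}=\sum_{j=1}^k(-1)^{j-1}j\,E_j^{(s)}H_{k-j}^{(s)}$. \end{enumerate}
   Context: For a positive integer $s$, $H_k^{(s)}$ and $E_k^{(s)}$ ($k\ge0$) are defined by the formal power series identities $$\sum_{k\ge0}H_k^{(s)}(x_1,\ldots,x_n)t^k=\prod_{i=1}^n\big(1-x_it+\cdots+(-x_it)^s\big)^{ -1},\qquad \sum_{k\ge0}E_k^{(s)}(x_1,\ldots,x_n)t^k=\prod_{i=1}^n\big(1+x_it+\cdots+(x_it)^s\big).$$ $p_k(x_1,\ldots,x_n)=\sum_{i=1}^n x_i^k$ is the power sum symmetric function, and $P_k^{(s)}(x_1,\ldots,x_n)=c_k^{(s)}p_k(x_1,\ldots,x_n)$ where $c_k^{(s)}=(-1)^k s$ if $k\equiv0\pmod{s+1}$ and $c_k^{(s)}=(-1)^{k-1}$ otherwise. -}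

module Defs where

open import Algebra.Bundles using (CommutativeRing)
open import Data.Nat using (ℕ; zero; suc; _∸_; _≤?_)
open import Data.Nat.Divisibility using (_∣?_)
open import Data.Fin using (Fin) renaming (zero to fzero; suc to fsuc)
open import Relation.Nullary using (yes; no)

-- All polynomial identities are stated after evaluation at arbitrary
-- elements x : Fin n → R of an arbitrary commutative ring R (taking R to be
-- the polynomial ring ℤ[x₁,…,xₙ] recovers the identity of polynomials).
module Poly {c ℓ} (R : CommutativeRing c ℓ) where
  open CommutativeRing R

  Series : Set c
  Series = ℕ → Carrier

  pow : Carrier → ℕ → Carrier
  pow x zero = 1#
  pow x (suc m) = pow x m * x

  nat· : ℕ → Carrier → Carrier
  nat· zero x = 0#
  nat· (suc m) x = nat· m x + x

  sign : ℕ → Carrier → Carrier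
  sign zero x = x
  sign (suc m) x = - sign m x

  sum1 : ℕ → (ℕ → Carrier) → Carrier
  sum1 zero f = 0#
  sum1 (suc k) f = sum1 k f + f (suc k)

  sumFin : (n : ℕ) → (Fin n → Carrier) → Carrier
  sumFin zero f = 0#
  sumFin (suc n) f = f fzero + sumFin n (λ i → f (fsuc i))

  _⊙_ : Series → Series → Series
  (f ⊙ g) k = f 0 * g k + sum1 k (λ j → f j * g (k ∸ j))

  one : Series
  one zero = 1#
  one (suc k) = 0#

  prodFin : (n : ℕ) → (Fin n → Series) → Series
  prodFin zero F = one
  prodFin (suc n) F = F fzero ⊙ prodFin n (λ i → F (fsuc i))

  -- multiplicative inverse of a series f with f_0 = 1:
  -- g_0 = 1, g_m = - Σ_{j=1}^{m} f_j g_{m-j}.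
  -- invTable f k m = g_m for m ≤ k.
  invTable : Series → ℕ → Series
  invTable f zero m = 1#
  invTable f (suc k) m with m ≤? k
  ... | yes _ = invTable f k m
  ... | no _ = - sum1 (suc k) (λ j → f j * invTable f k (suc k ∸ j))

  inv : Series → Series
  inv f k = invTable f k k

  eFactor : ℕ → Carrier → Series
  eFactor s x j with j ≤? s
  ... | yes _ = pow x j
  ... | no _ = 0#

  hFactor : ℕ → Carrier → Series
  hFactor s x j with j ≤? s
  ... | yes _ = sign j (pow x j)
  ... | no _ = 0#

  E : (s n : ℕ) → (Fin n → Carrier) → Series
  E s n x = prodFin n (λ i → eFactor s (x i))

  H : (s n : ℕ) → (Fin n → Carrier) → Series
  H s n x = prodFin n (λ i → inv (hFactor s (x i)))

  p : (n : ℕ) → (Fin n → Carrier) → ℕ → Carrier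
  p n x k = sumFin n (λ i → pow (x i) k)

  P : (s n : ℕ) → (Fin n → Carrier) → ℕ → Carrier
  P s n x k with suc s ∣? k
  ... | yes _ = sign k (nat· s (p n x k))
  ... | no _ = sign (k ∸ 1) (p n x k)

-- With θ = t·d/dt, a factor e = 1 + yt + ⋯ + (yt)^s of E satisfies
-- (1 − yt)·e = 1 − (yt)^{s+1} and (1 − yt)·θe = (1 − (yt)^{s+1})·q, where
-- q_j = (−1)^{j−1} c_j^{(s)} y^j; cancelling the unit 1 − yt gives θe = q·e.
-- Logarithmic derivatives add over products, so θE = Q·E with
-- Q_j = (−1)^{j−1} P_j^{(s)}: this is identity 1. The factors of H are the
-- inverses of those of E(−t), so H·E(−t) = 1; hence θH = −Q(−t)·H, which is
-- identity 2, and Q(−t) = θ(E(−t))·H, which is identity 3.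
module Submission where

open import Algebra.Bundles using (CommutativeRing)
import Algebra.Construct.Pointwise as Pointwise
import Algebra.Properties.CommutativeSemigroup as CommutativeSemigroupProperties
import Algebra.Properties.Ring as RingProperties
open import Data.Empty using (⊥-elim)
open import Data.Fin using (Fin) renaming (zero to fzero; suc to fsuc)
open import Data.Maybe using (nothing)
open import Data.Nat using (ℕ; zero; suc; _≤_; _<_; _∸_; z≤n; s≤s; _≤?_)
  renaming (_+_ to _+ℕ_)
open import Data.Nat.Divisibility using (_∣_; _∣?_; ∣-refl; ∣⇒≤; ∣m∣n⇒∣m+n; ∣m+n∣m⇒∣n)
import Data.Nat.Properties as ℕ
open import Data.Product using (_×_; _,_)
open import Data.Sum using (inj₁; inj₂)
open import Relation.Binary.Definitions using (tri<; tri≈; tri>)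
open import Relation.Binary.PropositionalEquality as ≡ using (_≡_; _≢_)
import Relation.Binary.Reasoning.Setoid as SetoidReasoning
open import Relation.Nullary using (Dec; yes; no; ¬_)
open import Tactic.RingSolver.Core.AlmostCommutativeRing using (fromCommutativeRing)

open import Defs

module Scalar {c ℓ} (R : CommutativeRing c ℓ) where
  open CommutativeRing R
  open Poly R
  open RingProperties ring
  open CommutativeSemigroupProperties +-commutativeSemigroup using ()
    renaming (interchange to +-interchange)
  open CommutativeSemigroupProperties *-commutativeSemigroup using (xy∙z≈xz∙y)

  nat·-cong : ∀ k {a b} → a ≈ b → nat· k a ≈ nat· k b
  nat·-cong zero    a≈b = refl
  nat·-cong (suc k) a≈b = +-cong (nat·-cong k a≈b) a≈b

  nat·-zeroʳ : ∀ k → nat· k 0# ≈ 0#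
  nat·-zeroʳ zero    = refl
  nat·-zeroʳ (suc k) = trans (+-identityʳ _) (nat·-zeroʳ k)

  nat·-distrib-+ : ∀ k a b → nat· k (a + b) ≈ nat· k a + nat· k b
  nat·-distrib-+ zero    a b = sym (+-identityʳ 0#)
  nat·-distrib-+ (suc k) a b = trans (+-congʳ (nat·-distrib-+ k a b)) (+-interchange _ _ _ _)

  nat·-*-comm : ∀ k a b → nat· k (a * b) ≈ a * nat· k b
  nat·-*-comm zero    a b = sym (zeroʳ a)
  nat·-*-comm (suc k) a b = trans (+-congʳ (nat·-*-comm k a b)) (sym (distribˡ a _ _))

  nat·-*-assoc : ∀ k a b → nat· k (a * b) ≈ nat· k a * b
  nat·-*-assoc zero    a b = sym (zeroˡ b)
  nat·-*-assoc (suc k) a b = trans (+-congʳ (nat·-*-assoc k a b)) (sym (distribʳ b _ _))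

  nat·-neg : ∀ k a → nat· k (- a) ≈ - nat· k a
  nat·-neg zero    a = sym -0#≈0#
  nat·-neg (suc k) a = trans (+-congʳ (nat·-neg k a)) (-‿+-comm _ _)

  sign-cong : ∀ k {a b} → a ≈ b → sign k a ≈ sign k b
  sign-cong zero    a≈b = a≈b
  sign-cong (suc k) a≈b = -‿cong (sign-cong k a≈b)

  sign-zero : ∀ k → sign k 0# ≈ 0#
  sign-zero zero    = refl
  sign-zero (suc k) = trans (-‿cong (sign-zero k)) -0#≈0#

  sign-distrib-+ : ∀ k a b → sign k (a + b) ≈ sign k a + sign k b
  sign-distrib-+ zero    a b = refl
  sign-distrib-+ (suc k) a b = trans (-‿cong (sign-distrib-+ k a b)) (sym (-‿+-comm _ _))

  sign-*-comm : ∀ k a b → sign k (a * b) ≈ a * sign k b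
  sign-*-comm zero    a b = refl
  sign-*-comm (suc k) a b = trans (-‿cong (sign-*-comm k a b)) (-‿distribʳ-* _ _)

  sign-*-assoc : ∀ k a b → sign k (a * b) ≈ sign k a * b
  sign-*-assoc zero    a b = refl
  sign-*-assoc (suc k) a b = trans (-‿cong (sign-*-assoc k a b)) (-‿distribˡ-* _ _)

  sign-neg : ∀ k a → sign k (- a) ≈ - sign k a
  sign-neg zero    a = refl
  sign-neg (suc k) a = -‿cong (sign-neg k a)

  sign-involutive : ∀ k a → sign k (sign k a) ≈ a
  sign-involutive zero    a = refl
  sign-involutive (suc k) a =
    trans (-‿cong (sign-neg k _)) (trans (-‿involutive _) (sign-involutive k a))

  sign-nat· : ∀ j k a → sign j (nat· k a) ≈ nat· k (sign j a)
  sign-nat· zero    k a = refl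
  sign-nat· (suc j) k a = trans (-‿cong (sign-nat· j k a)) (sym (nat·-neg k _))

  sum1-cong : ∀ k {f g : ℕ → Carrier} → (∀ j → 1 ≤ j → j ≤ k → f j ≈ g j) →
              sum1 k f ≈ sum1 k g
  sum1-cong zero    f≈g = refl
  sum1-cong (suc k) f≈g =
    +-cong (sum1-cong k (λ j 1≤j j≤k → f≈g j 1≤j (ℕ.m≤n⇒m≤1+n j≤k))) (f≈g (suc k) (s≤s z≤n) ℕ.≤-refl)

  sumFin-cong : ∀ n {F G : Fin n → Carrier} → (∀ i → F i ≈ G i) → sumFin n F ≈ sumFin n G
  sumFin-cong zero    F≈G = refl
  sumFin-cong (suc n) F≈G = +-cong (F≈G fzero) (sumFin-cong n (λ i → F≈G (fsuc i)))

  sumFin-zero : ∀ n → sumFin n (λ _ → 0#) ≈ 0#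
  sumFin-zero zero    = refl
  sumFin-zero (suc n) = trans (+-identityˡ _) (sumFin-zero n)

  sumFin-neg : ∀ n (F : Fin n → Carrier) → sumFin n (λ i → - F i) ≈ - sumFin n F
  sumFin-neg zero    F = sym -0#≈0#
  sumFin-neg (suc n) F = trans (+-congˡ (sumFin-neg n _)) (-‿+-comm _ _)

  sumFin-nat· : ∀ n k (F : Fin n → Carrier) →
                sumFin n (λ i → nat· k (F i)) ≈ nat· k (sumFin n F)
  sumFin-nat· zero    k F = sym (nat·-zeroʳ k)
  sumFin-nat· (suc n) k F = trans (+-congˡ (sumFin-nat· n k _)) (sym (nat·-distrib-+ k _ _))

  pow-+ : ∀ y a b → pow y (a +ℕ b) ≈ pow y a * pow y b
  pow-+ y zero    b = sym (*-identityˡ _)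
  pow-+ y (suc a) b = trans (*-congʳ (pow-+ y a b)) (xy∙z≈xz∙y _ _ _)

module SeriesRing {c ℓ} (R : CommutativeRing c ℓ) where
  open CommutativeRing R
  open Poly R
  open Scalar R
  open RingProperties ring
  open CommutativeSemigroupProperties +-commutativeSemigroup using ()
    renaming (interchange to +-interchange)
  open SetoidReasoning setoid
  open import Tactic.RingSolver.NonReflective (fromCommutativeRing R (λ _ → nothing))

  infix 4 _≋_
  _≋_ : Series → Series → Set ℓ
  f ≋ g = ∀ k → f k ≈ g k

  infixl 6 _+ˢ_
  _+ˢ_ : Series → Series → Series
  (f +ˢ g) k = f k + g k

  -ˢ_ : Series → Series
  (-ˢ f) k = - f k

  0ˢ : Series
  0ˢ k = 0#

  shift : Series → Series
  shift f k = f (suc k)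

  -- ⊙ by recursion on the index, from f = f₀ + t · shift f; the ring laws are
  -- proved for conv by induction and transferred to ⊙ along ⊙≋conv.
  conv : Series → Series → Series
  conv f g zero    = f 0 * g 0
  conv f g (suc k) = f 0 * g (suc k) + conv (shift f) g k

  conv-cong : ∀ {f f′ g g′} → f ≋ f′ → g ≋ g′ → conv f g ≋ conv f′ g′
  conv-cong f≋f′ g≋g′ zero    = *-cong (f≋f′ 0) (g≋g′ 0)
  conv-cong f≋f′ g≋g′ (suc k) =
    +-cong (*-cong (f≋f′ 0) (g≋g′ (suc k))) (conv-cong (λ j → f≋f′ (suc j)) g≋g′ k)

  conv-distribʳ : ∀ f f′ g → conv (f +ˢ f′) g ≋ conv f g +ˢ conv f′ g
  conv-distribʳ f f′ g zero    = distribʳ _ _ _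
  conv-distribʳ f f′ g (suc k) =
    trans (+-cong (distribʳ _ _ _) (conv-distribʳ (shift f) (shift f′) g k)) (+-interchange _ _ _ _)

  conv-scaleˡ : ∀ a f g k → conv (λ j → a * f j) g k ≈ a * conv f g k
  conv-scaleˡ a f g zero    = *-assoc _ _ _
  conv-scaleˡ a f g (suc k) =
    trans (+-cong (*-assoc _ _ _) (conv-scaleˡ a (shift f) g k)) (sym (distribˡ _ _ _))

  conv-negˡ : ∀ f g → conv (-ˢ f) g ≋ -ˢ conv f g
  conv-negˡ f g zero    = sym (-‿distribˡ-* _ _)
  conv-negˡ f g (suc k) =
    trans (+-cong (sym (-‿distribˡ-* _ _)) (conv-negˡ (shift f) g k)) (-‿+-comm _ _)

  conv-zeroˡ : ∀ g → conv 0ˢ g ≋ 0ˢ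
  conv-zeroˡ g zero    = zeroˡ _
  conv-zeroˡ g (suc k) = trans (+-cong (zeroˡ _) (conv-zeroˡ g k)) (+-identityʳ _)

  conv-identityˡ : ∀ g → conv one g ≋ g
  conv-identityˡ g zero    = *-identityˡ _
  conv-identityˡ g (suc k) = trans (+-cong (*-identityˡ _) (conv-zeroˡ g k)) (+-identityʳ _)

  conv-unfoldʳ : ∀ f g k → conv f g (suc k) ≈ conv f (shift g) k + f (suc k) * g 0
  conv-unfoldʳ f g zero    = refl
  conv-unfoldʳ f g (suc k) = trans (+-congˡ (conv-unfoldʳ (shift f) g k)) (sym (+-assoc _ _ _))

  conv-comm : ∀ f g → conv f g ≋ conv g f
  conv-comm f g zero    = *-comm _ _
  conv-comm f g (suc k) = begin
    f 0 * g (suc k) + conv (shift f) g k ≈⟨ +-cong (*-comm _ _) (conv-comm (shift f) g k) ⟩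
    g (suc k) * f 0 + conv g (shift f) k ≈⟨ +-comm _ _ ⟩
    conv g (shift f) k + g (suc k) * f 0 ≈⟨ conv-unfoldʳ g f k ⟨
    conv g f (suc k)                     ∎

  conv-assoc : ∀ f g h → conv (conv f g) h ≋ conv f (conv g h)
  conv-assoc f g h zero    = *-assoc _ _ _
  conv-assoc f g h (suc k) = begin
    (f 0 * g 0) * h (suc k) + conv (λ j → f 0 * g (suc j) + conv (shift f) g j) h k
      ≈⟨ +-cong (*-assoc _ _ _) (conv-distribʳ (λ j → f 0 * g (suc j)) (conv (shift f) g) h k) ⟩
    f 0 * (g 0 * h (suc k)) + (conv (λ j → f 0 * g (suc j)) h k + conv (conv (shift f) g) h k)
      ≈⟨ +-congˡ (+-cong (conv-scaleˡ (f 0) (shift g) h k) (conv-assoc (shift f) g h k)) ⟩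
    f 0 * (g 0 * h (suc k)) + (f 0 * conv (shift g) h k + conv (shift f) (conv g h) k)
      ≈⟨ +-assoc _ _ _ ⟨
    (f 0 * (g 0 * h (suc k)) + f 0 * conv (shift g) h k) + conv (shift f) (conv g h) k
      ≈⟨ +-congʳ (distribˡ _ _ _) ⟨
    f 0 * (g 0 * h (suc k) + conv (shift g) h k) + conv (shift f) (conv g h) k ∎

  ⊙-unfoldʳ : ∀ f g k → (f ⊙ g) (suc k) ≈ (f ⊙ shift g) k + f (suc k) * g 0
  ⊙-unfoldʳ f g k = begin
    f 0 * g (suc k) + (sum1 k (λ j → f j * g (suc k ∸ j)) + f (suc k) * g (suc k ∸ suc k))
      ≈⟨ +-congˡ (+-cong (sum1-cong k (λ j _ j≤k → *-congˡ (reflexive (≡.cong g (ℕ.+-∸-assoc 1 j≤k)))))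
                         (*-congˡ (reflexive (≡.cong g (ℕ.n∸n≡0 k))))) ⟩
    f 0 * g (suc k) + (sum1 k (λ j → f j * shift g (k ∸ j)) + f (suc k) * g 0)
      ≈⟨ +-assoc _ _ _ ⟨
    (f ⊙ shift g) k + f (suc k) * g 0 ∎

  ⊙≋conv : ∀ f g → f ⊙ g ≋ conv f g
  ⊙≋conv f g zero    = +-identityʳ _
  ⊙≋conv f g (suc k) =
    trans (⊙-unfoldʳ f g k) (trans (+-congʳ (⊙≋conv f (shift g) k)) (sym (conv-unfoldʳ f g k)))

  ⊙-via-conv : ∀ {f g f′ g′} → conv f g ≋ conv f′ g′ → f ⊙ g ≋ f′ ⊙ g′
  ⊙-via-conv {f} {g} {f′} {g′} eq k = trans (⊙≋conv f g k) (trans (eq k) (sym (⊙≋conv f′ g′ k)))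

  ⊙-cong : ∀ {f f′ g g′} → f ≋ f′ → g ≋ g′ → f ⊙ g ≋ f′ ⊙ g′
  ⊙-cong f≋f′ g≋g′ = ⊙-via-conv (conv-cong f≋f′ g≋g′)

  ⊙-comm : ∀ f g → f ⊙ g ≋ g ⊙ f
  ⊙-comm f g = ⊙-via-conv (conv-comm f g)

  ⊙-assoc : ∀ f g h → (f ⊙ g) ⊙ h ≋ f ⊙ (g ⊙ h)
  ⊙-assoc f g h = ⊙-via-conv λ k → begin
    conv (f ⊙ g) h k   ≈⟨ conv-cong (⊙≋conv f g) (λ _ → refl) k ⟩
    conv (conv f g) h k ≈⟨ conv-assoc f g h k ⟩
    conv f (conv g h) k ≈⟨ conv-cong (λ _ → refl) (⊙≋conv g h) k ⟨
    conv f (g ⊙ h) k   ∎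

  ⊙-identityˡ : ∀ g → one ⊙ g ≋ g
  ⊙-identityˡ g k = trans (⊙≋conv one g k) (conv-identityˡ g k)

  ⊙-identityʳ : ∀ g → g ⊙ one ≋ g
  ⊙-identityʳ g k = trans (⊙-comm g one k) (⊙-identityˡ g k)

  ⊙-distribʳ : ∀ h f g → (f +ˢ g) ⊙ h ≋ f ⊙ h +ˢ g ⊙ h
  ⊙-distribʳ h f g k =
    trans (⊙≋conv _ _ k) (trans (conv-distribʳ f g h k) (sym (+-cong (⊙≋conv f h k) (⊙≋conv g h k))))

  ⊙-distribˡ : ∀ h f g → h ⊙ (f +ˢ g) ≋ h ⊙ f +ˢ h ⊙ g
  ⊙-distribˡ h f g k =
    trans (⊙-comm h _ k) (trans (⊙-distribʳ h f g k) (+-cong (⊙-comm f h k) (⊙-comm g h k)))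

  seriesCommutativeRing : CommutativeRing c ℓ
  seriesCommutativeRing = record
    { Carrier = Series
    ; _≈_ = _≋_
    ; _+_ = _+ˢ_
    ; _*_ = _⊙_
    ; -_ = -ˢ_
    ; 0# = 0ˢ
    ; 1# = one
    ; isCommutativeRing = record
      { isRing = record
        { +-isAbelianGroup = Pointwise.isAbelianGroup ℕ +-isAbelianGroup
        ; *-cong = ⊙-cong
        ; *-assoc = ⊙-assoc
        ; *-identity = ⊙-identityˡ , ⊙-identityʳ
        ; distrib = ⊙-distribˡ , ⊙-distribʳ
        }
      ; *-comm = ⊙-comm
      }
    }

  θ : Series → Series
  θ f k = nat· k (f k)

  θ-cong : ∀ {f g} → f ≋ g → θ f ≋ θ g
  θ-cong f≋g k = nat·-cong k (f≋g k)

  θ-one : θ one ≋ 0ˢ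
  θ-one zero    = refl
  θ-one (suc k) = nat·-zeroʳ (suc k)

  conv-θ : ∀ f g → θ (conv f g) ≋ conv (θ f) g +ˢ conv f (θ g)
  conv-θ f g zero    = sym (trans (+-cong (zeroˡ _) (zeroʳ _)) (+-identityʳ _))
  conv-θ f g (suc k) = begin
    nat· k (f 0 * g′ + B) + (f 0 * g′ + B)
      ≈⟨ +-congʳ (trans (nat·-distrib-+ k _ B) (+-cong (nat·-*-comm k _ _) (conv-θ (shift f) g k))) ⟩
    (f 0 * nat· k g′ + (C + D)) + (f 0 * g′ + B)
      ≈⟨ rearrange (f 0) g′ (nat· k g′) B C D ⟩
    (C + B) + (f 0 * θ g (suc k) + D)
      ≈⟨ +-congʳ (trans (+-congʳ (zeroˡ _)) (trans (+-identityˡ _) (conv-distribʳ (θ (shift f)) (shift f) g k))) ⟨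
    (θ f 0 * g′ + conv (shift (θ f)) g k) + (f 0 * θ g (suc k) + D) ∎
    where
    g′ B C D : Carrier
    g′ = g (suc k)
    B = conv (shift f) g k
    C = conv (θ (shift f)) g k
    D = conv (shift f) (θ g) k
    rearrange : ∀ a b n x y z → (a * n + (y + z)) + (a * b + x) ≈ (y + x) + (a * (n + b) + z)
    rearrange = solve 6 (λ a b n x y z →
      ((a ⊗ n ⊕ (y ⊕ z)) ⊕ (a ⊗ b ⊕ x)) ⊜ ((y ⊕ x) ⊕ (a ⊗ (n ⊕ b) ⊕ z))) refl

  infix 25 _[-t]
  _[-t] : Series → Series
  (f [-t]) k = sign k (f k)

  [-t]-cong : ∀ {f g} → f ≋ g → f [-t] ≋ g [-t]
  [-t]-cong f≋g k = sign-cong k (f≋g k)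

  one-[-t] : one [-t] ≋ one
  one-[-t] zero    = refl
  one-[-t] (suc k) = sign-zero (suc k)

  θ-[-t] : ∀ f → θ (f [-t]) ≋ (θ f) [-t]
  θ-[-t] f k = sym (sign-nat· k k (f k))

  conv-[-t] : ∀ f g → conv f g [-t] ≋ conv (f [-t]) (g [-t])
  conv-[-t] f g zero    = refl
  conv-[-t] f g (suc k) = begin
    - sign k (f 0 * g (suc k) + conv (shift f) g k)
      ≈⟨ -‿cong (sign-distrib-+ k _ _) ⟩
    - (sign k (f 0 * g (suc k)) + sign k (conv (shift f) g k))
      ≈⟨ -‿+-comm _ _ ⟨
    - sign k (f 0 * g (suc k)) + - sign k (conv (shift f) g k)
      ≈⟨ +-cong (-‿cong (sign-*-comm k _ _)) (-‿cong (conv-[-t] (shift f) g k)) ⟩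
    - (f 0 * sign k (g (suc k))) + - conv (shift f [-t]) (g [-t]) k
      ≈⟨ +-cong (-‿distribʳ-* _ _) (sym (conv-negˡ (shift f [-t]) (g [-t]) k)) ⟩
    f 0 * (g [-t]) (suc k) + conv (shift (f [-t])) (g [-t]) k ∎

  monomial : ℕ → Carrier → Series
  monomial zero    b zero    = b
  monomial zero    b (suc k) = 0#
  monomial (suc m) b zero    = 0#
  monomial (suc m) b (suc k) = monomial m b k

  monomial-≢ : ∀ m b {k} → k ≢ m → monomial m b k ≈ 0#
  monomial-≢ zero    b {zero}  k≢m = ⊥-elim (k≢m ≡.refl)
  monomial-≢ zero    b {suc k} k≢m = refl
  monomial-≢ (suc m) b {zero}  k≢m = refl
  monomial-≢ (suc m) b {suc k} k≢m = monomial-≢ m b (λ k≡m → k≢m (≡.cong suc k≡m))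

  monomial-diagonal : ∀ m b → monomial m b m ≡ b
  monomial-diagonal zero    b = ≡.refl
  monomial-diagonal (suc m) b = monomial-diagonal m b

  conv-monomial : ∀ m b f k → conv (monomial m b) f (m +ℕ k) ≈ b * f k
  conv-monomial zero    b f zero    = refl
  conv-monomial zero    b f (suc k) = trans (+-congˡ (conv-zeroˡ f k)) (+-identityʳ _)
  conv-monomial (suc m) b f k       =
    trans (+-congʳ (zeroˡ _)) (trans (+-identityˡ _) (conv-monomial m b f k))

  conv-monomial-< : ∀ m b f {k} → k < m → conv (monomial m b) f k ≈ 0#
  conv-monomial-< (suc m) b f {zero}  _         = zeroˡ _
  conv-monomial-< (suc m) b f {suc k} (s≤s k<m) =
    trans (+-congʳ (zeroˡ _)) (trans (+-identityˡ _) (conv-monomial-< m b f k<m))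

  θ-⊙ : ∀ f g → θ (f ⊙ g) ≋ θ f ⊙ g +ˢ f ⊙ θ g
  θ-⊙ f g k = begin
    nat· k ((f ⊙ g) k)            ≈⟨ nat·-cong k (⊙≋conv f g k) ⟩
    θ (conv f g) k                ≈⟨ conv-θ f g k ⟩
    conv (θ f) g k + conv f (θ g) k ≈⟨ +-cong (⊙≋conv (θ f) g k) (⊙≋conv f (θ g) k) ⟨
    (θ f ⊙ g) k + (f ⊙ θ g) k     ∎

  [-t]-⊙ : ∀ f g → (f ⊙ g) [-t] ≋ f [-t] ⊙ g [-t]
  [-t]-⊙ f g k = begin
    sign k ((f ⊙ g) k)           ≈⟨ sign-cong k (⊙≋conv f g k) ⟩
    (conv f g [-t]) k            ≈⟨ conv-[-t] f g k ⟩
    conv (f [-t]) (g [-t]) k     ≈⟨ ⊙≋conv (f [-t]) (g [-t]) k ⟨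
    (f [-t] ⊙ g [-t]) k          ∎

  binomial : ℕ → Carrier → Series
  binomial m b = one +ˢ monomial m b

  binomial-⊙ : ∀ m b f k → (binomial m b ⊙ f) k ≈ f k + conv (monomial m b) f k
  binomial-⊙ m b f k =
    trans (⊙-distribʳ f one (monomial m b) k) (+-cong (⊙-identityˡ f k) (⊙≋conv _ f k))

  binomial-⊙-< : ∀ m b f {k} → k < m → (binomial m b ⊙ f) k ≈ f k
  binomial-⊙-< m b f {k} k<m =
    trans (binomial-⊙ m b f k) (trans (+-congˡ (conv-monomial-< m b f k<m)) (+-identityʳ _))

  binomial-⊙-+ : ∀ m b f k → (binomial m b ⊙ f) (m +ℕ k) ≈ f (m +ℕ k) + b * f k
  binomial-⊙-+ m b f k = trans (binomial-⊙ m b f (m +ℕ k)) (+-congˡ (conv-monomial m b f k))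

  binomial-⊙-diagonal : ∀ m b f → (binomial m b ⊙ f) m ≈ f m + b * f 0
  binomial-⊙-diagonal m b f =
    ≡.subst (λ i → (binomial m b ⊙ f) i ≈ f i + b * f 0) (ℕ.+-identityʳ m) (binomial-⊙-+ m b f 0)

  ⊙-coefficient : ∀ {f} g k → f 0 ≈ 0# → (f ⊙ g) k ≈ sum1 k (λ j → f j * g (k ∸ j))
  ⊙-coefficient g k f₀≈0 = trans (+-congʳ (trans (*-congʳ f₀≈0) (zeroˡ _))) (+-identityˡ _)

  inv-suc : ∀ f k → inv f (suc k) ≡ - sum1 (suc k) (λ j → f j * invTable f k (suc k ∸ j))
  inv-suc f k with suc k ≤? k
  ... | yes k<k = ⊥-elim (ℕ.<-irrefl ≡.refl k<k)
  ... | no _    = ≡.refl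

  invTable-stable : ∀ f k m → m ≤ k → invTable f k m ≡ inv f m
  invTable-stable f zero    zero m≤k = ≡.refl
  invTable-stable f (suc k) m    m≤k with m ≤? k
  ... | yes m≤k′ = invTable-stable f k m m≤k′
  ... | no  m≰k  with ℕ.m≤n⇒m<n∨m≡n m≤k
  ...   | inj₁ m<1+k  = ⊥-elim (m≰k (ℕ.≤-pred m<1+k))
  ...   | inj₂ ≡.refl = ≡.sym (inv-suc f k)

  inv-inverseʳ : ∀ f → f 0 ≈ 1# → f ⊙ inv f ≋ one
  inv-inverseʳ f f₀≈1 zero    = trans (+-identityʳ _) (trans (*-congʳ f₀≈1) (*-identityˡ _))
  inv-inverseʳ f f₀≈1 (suc k) = begin
    f 0 * inv f (suc k) + S
      ≈⟨ +-congʳ (trans (*-cong f₀≈1 (reflexive (inv-suc f k))) (*-identityˡ _)) ⟩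
    - sum1 (suc k) (λ j → f j * invTable f k (suc k ∸ j)) + S
      ≈⟨ +-congʳ (-‿cong (sum1-cong (suc k) stable)) ⟩
    - S + S
      ≈⟨ -‿inverseˡ S ⟩
    0# ∎
    where
    S : Carrier
    S = sum1 (suc k) (λ j → f j * inv f (suc k ∸ j))
    stable : ∀ j → 1 ≤ j → j ≤ suc k → f j * invTable f k (suc k ∸ j) ≈ f j * inv f (suc k ∸ j)
    stable (suc j) _ _ = *-congˡ (reflexive (invTable-stable f k (k ∸ j) (ℕ.m∸n≤m k j)))

module LogarithmicDerivative {c ℓ} (R : CommutativeRing c ℓ) where
  open Poly R
  open SeriesRing R
  module S = CommutativeRing seriesCommutativeRing
  open RingProperties S.ring using (+-inverseʳ-unique)
  open CommutativeSemigroupProperties S.*-commutativeSemigroup using (interchange; x∙yz≈y∙xz)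
  open SetoidReasoning S.setoid

  prodFin-cong : ∀ n {F G : Fin n → Series} → (∀ i → F i ≋ G i) → prodFin n F ≋ prodFin n G
  prodFin-cong zero    F≋G = S.refl
  prodFin-cong (suc n) F≋G = ⊙-cong (F≋G fzero) (prodFin-cong n (λ i → F≋G (fsuc i)))

  prodFin-⊙ : ∀ n (F G : Fin n → Series) →
              prodFin n (λ i → F i ⊙ G i) ≋ prodFin n F ⊙ prodFin n G
  prodFin-⊙ zero    F G = S.sym (⊙-identityˡ one)
  prodFin-⊙ (suc n) F G = S.trans (⊙-cong S.refl (prodFin-⊙ n _ _)) (interchange _ _ _ _)

  prodFin-one : ∀ n → prodFin n (λ _ → one) ≋ one
  prodFin-one zero    = S.refl
  prodFin-one (suc n) = S.trans (⊙-cong S.refl (prodFin-one n)) (⊙-identityˡ one)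

  prodFin-[-t] : ∀ n (F : Fin n → Series) → prodFin n F [-t] ≋ prodFin n (λ i → F i [-t])
  prodFin-[-t] zero    F = one-[-t]
  prodFin-[-t] (suc n) F = S.trans ([-t]-⊙ _ _) (⊙-cong S.refl (prodFin-[-t] n _))

  sumSeries : (n : ℕ) → (Fin n → Series) → Series
  sumSeries n F k = sumFin n (λ i → F i k)

  ⊙-cancelˡ : ∀ {a b g l} → g ⊙ l ≋ one → l ⊙ a ≋ l ⊙ b → a ≋ b
  ⊙-cancelˡ {a} {b} {g} {l} gl≋1 la≋lb = begin
    a             ≈⟨ S.*-identityˡ a ⟨
    one ⊙ a       ≈⟨ ⊙-cong gl≋1 S.refl ⟨
    (g ⊙ l) ⊙ a   ≈⟨ ⊙-assoc g l a ⟩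
    g ⊙ (l ⊙ a)   ≈⟨ ⊙-cong S.refl la≋lb ⟩
    g ⊙ (l ⊙ b)   ≈⟨ ⊙-assoc g l b ⟨
    (g ⊙ l) ⊙ b   ≈⟨ ⊙-cong gl≋1 S.refl ⟩
    one ⊙ b       ≈⟨ S.*-identityˡ b ⟩
    b             ∎

  infix 4 _hasLogDerivative_
  _hasLogDerivative_ : Series → Series → Set ℓ
  f hasLogDerivative r = θ f ≋ r ⊙ f

  logDerivative-⊙ : ∀ {f g r r′} → f hasLogDerivative r → g hasLogDerivative r′ →
                    f ⊙ g hasLogDerivative r +ˢ r′
  logDerivative-⊙ {f} {g} {r} {r′} θf θg = begin
    θ (f ⊙ g)                ≈⟨ θ-⊙ f g ⟩
    θ f ⊙ g +ˢ f ⊙ θ g       ≈⟨ S.+-cong (⊙-cong θf S.refl) (⊙-cong S.refl θg) ⟩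
    (r ⊙ f) ⊙ g +ˢ f ⊙ (r′ ⊙ g) ≈⟨ S.+-cong (⊙-assoc r f g) (x∙yz≈y∙xz f r′ g) ⟩
    r ⊙ (f ⊙ g) +ˢ r′ ⊙ (f ⊙ g) ≈⟨ S.distribʳ (f ⊙ g) r r′ ⟨
    (r +ˢ r′) ⊙ (f ⊙ g)       ∎

  logDerivative-prodFin : ∀ n {F Q : Fin n → Series} → (∀ i → F i hasLogDerivative Q i) →
                          prodFin n F hasLogDerivative sumSeries n Q
  logDerivative-prodFin zero    _  = S.trans θ-one (S.sym (S.zeroˡ one))
  logDerivative-prodFin (suc n) θF =
    logDerivative-⊙ (θF fzero) (logDerivative-prodFin n (λ i → θF (fsuc i)))

  logDerivative-[-t] : ∀ {f r} → f hasLogDerivative r → f [-t] hasLogDerivative r [-t]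
  logDerivative-[-t] {f} {r} θf = begin
    θ (f [-t])          ≈⟨ θ-[-t] f ⟩
    θ f [-t]            ≈⟨ [-t]-cong θf ⟩
    (r ⊙ f) [-t]        ≈⟨ [-t]-⊙ r f ⟩
    r [-t] ⊙ f [-t]     ∎

  logDerivative≋θ⊙inverse : ∀ {f g r} → f ⊙ g ≋ one → f hasLogDerivative r → r ≋ θ f ⊙ g
  logDerivative≋θ⊙inverse {f} {g} {r} fg≋1 θf = begin
    r               ≈⟨ S.*-identityʳ r ⟨
    r ⊙ one         ≈⟨ ⊙-cong S.refl fg≋1 ⟨
    r ⊙ (f ⊙ g)     ≈⟨ ⊙-assoc r f g ⟨
    (r ⊙ f) ⊙ g     ≈⟨ ⊙-cong θf S.refl ⟨
    θ f ⊙ g         ∎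

  logDerivative-inverse : ∀ {f g r} → f ⊙ g ≋ one → f hasLogDerivative r →
                          g hasLogDerivative -ˢ r
  logDerivative-inverse {f} {g} {r} fg≋1 θf = begin
    θ g                  ≈⟨ S.*-identityˡ (θ g) ⟨
    one ⊙ θ g            ≈⟨ ⊙-cong (S.trans (⊙-comm g f) fg≋1) S.refl ⟨
    (g ⊙ f) ⊙ θ g        ≈⟨ ⊙-assoc g f (θ g) ⟩
    g ⊙ (f ⊙ θ g)        ≈⟨ ⊙-cong S.refl f⊙θg ⟩
    g ⊙ (-ˢ (θ f ⊙ g))   ≈⟨ ⊙-cong S.refl (S.-‿cong (logDerivative≋θ⊙inverse fg≋1 θf)) ⟨
    g ⊙ (-ˢ r)           ≈⟨ ⊙-comm g (-ˢ r) ⟩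
    (-ˢ r) ⊙ g           ∎
    where
    f⊙θg : f ⊙ θ g ≋ -ˢ (θ f ⊙ g)
    f⊙θg = +-inverseʳ-unique (θ f ⊙ g) (f ⊙ θ g)
             (S.trans (S.sym (θ-⊙ f g)) (S.trans (θ-cong fg≋1) θ-one))

module TruncatedGeometricFactor {c ℓ} (R : CommutativeRing c ℓ) where
  open CommutativeRing R
  open Poly R
  open Scalar R
  open SeriesRing R
  open LogarithmicDerivative R using (_hasLogDerivative_; ⊙-cancelˡ)
  open RingProperties ring
  open SetoidReasoning setoid

  -- The logarithmic derivative θe/e of e = eFactor s y.
  qFactor : ℕ → Carrier → Series
  qFactor s y zero    = 0#
  qFactor s y (suc j) with suc s ∣? suc j
  ... | yes _ = - nat· s (pow y (suc j))
  ... | no  _ = pow y (suc j)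

  qFactor-∣ : ∀ s y m → suc s ∣ suc m → qFactor s y (suc m) ≈ - nat· s (pow y (suc m))
  qFactor-∣ s y m s+1∣m+1 with suc s ∣? suc m
  ... | yes _        = refl
  ... | no  s+1∤m+1 = ⊥-elim (s+1∤m+1 s+1∣m+1)

  qFactor-∤ : ∀ s y m → ¬ (suc s ∣ suc m) → qFactor s y (suc m) ≈ pow y (suc m)
  qFactor-∤ s y m s+1∤m+1 with suc s ∣? suc m
  ... | yes s+1∣m+1 = ⊥-elim (s+1∤m+1 s+1∣m+1)
  ... | no  _        = refl

  qFactor-periodic : ∀ s y m → qFactor s y (suc s +ℕ suc m) ≈ pow y (suc s) * qFactor s y (suc m)
  qFactor-periodic s y m with suc s ∣? suc m
  ... | yes s+1∣m+1 = begin
    qFactor s y (suc s +ℕ suc m)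
      ≈⟨ qFactor-∣ s y (s +ℕ suc m) (∣m∣n⇒∣m+n ∣-refl s+1∣m+1) ⟩
    - nat· s (pow y (suc s +ℕ suc m))
      ≈⟨ -‿cong (nat·-cong s (pow-+ y (suc s) (suc m))) ⟩
    - nat· s (pow y (suc s) * pow y (suc m))
      ≈⟨ -‿cong (nat·-*-comm s _ _) ⟩
    - (pow y (suc s) * nat· s (pow y (suc m)))
      ≈⟨ -‿distribʳ-* _ _ ⟩
    pow y (suc s) * - nat· s (pow y (suc m)) ∎
  ... | no s+1∤m+1 =
    trans (qFactor-∤ s y (s +ℕ suc m) (λ s+1∣ → s+1∤m+1 (∣m+n∣m⇒∣n s+1∣ ∣-refl)))
          (pow-+ y (suc s) (suc m))

  data Position (s : ℕ) : ℕ → Set where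
    below : ∀ {k} → k < s → Position s k
    at    : Position s s
    above : ∀ j → Position s (s +ℕ suc j)

  position : ∀ s k → Position s k
  position s k with ℕ.<-cmp k s
  ... | tri< k<s _ _ = below k<s
  ... | tri≈ _ ≡.refl _ = at
  ... | tri> _ _ s<k with ℕ.m≤n⇒∃[o]m+o≡n s<k
  ...   | o , ≡.refl = ≡.subst (Position s) (ℕ.+-suc s o) (above o)

  module _ (s : ℕ) (y : Carrier) where
    private
      e q geometric : Series
      e = eFactor s y
      q = qFactor s y
      geometric = pow y
      b : Carrier
      b = - pow y (suc s)

      -y*-comm : ∀ a → - y * a ≈ - (a * y)
      -y*-comm a = trans (sym (-‿distribˡ-* y a)) (-‿cong (*-comm y a))

    eFactor-≤ : ∀ {j} → j ≤ s → e j ≈ pow y j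
    eFactor-≤ {j} j≤s with j ≤? s
    ... | yes _   = refl
    ... | no  j≰s = ⊥-elim (j≰s j≤s)

    eFactor-> : ∀ {j} → s < j → e j ≈ 0#
    eFactor-> {j} s<j with j ≤? s
    ... | yes j≤s = ⊥-elim (ℕ.<⇒≱ s<j j≤s)
    ... | no  _   = refl

    geometric-⊙-binomial : geometric ⊙ binomial 1 (- y) ≋ one
    geometric-⊙-binomial k = trans (⊙-comm geometric _ k) (coefficient k)
      where
      coefficient : binomial 1 (- y) ⊙ geometric ≋ one
      coefficient zero    = binomial-⊙-< 1 (- y) geometric (s≤s z≤n)
      coefficient (suc k) = trans (binomial-⊙-+ 1 (- y) geometric k)
                                  (trans (+-congˡ (-y*-comm _)) (-‿inverseʳ _))

    binomial-⊙-eFactor : binomial 1 (- y) ⊙ e ≋ binomial (suc s) b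
    binomial-⊙-eFactor zero    = begin
      (binomial 1 (- y) ⊙ e) 0 ≈⟨ binomial-⊙-< 1 (- y) e (s≤s z≤n) ⟩
      e 0                      ≈⟨ eFactor-≤ z≤n ⟩
      1#                       ≈⟨ +-identityʳ 1# ⟨
      1# + 0#                  ∎
    binomial-⊙-eFactor (suc k) = trans (binomial-⊙-+ 1 (- y) e k) (coefficient (position s k))
      where
      coefficient : Position s k → e (suc k) + - y * e k ≈ 0# + monomial s b k
      coefficient (below k<s) = begin
        e (suc k) + - y * e k       ≈⟨ +-cong (eFactor-≤ k<s) (trans (*-congˡ (eFactor-≤ (ℕ.<⇒≤ k<s))) (-y*-comm _)) ⟩
        pow y k * y + - (pow y k * y) ≈⟨ -‿inverseʳ _ ⟩
        0#                          ≈⟨ trans (+-identityˡ _) (monomial-≢ s b (ℕ.<⇒≢ k<s)) ⟨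
        0# + monomial s b k         ∎
      coefficient at = begin
        e (suc s) + - y * e s       ≈⟨ +-cong (eFactor-> ℕ.≤-refl) (trans (*-congˡ (eFactor-≤ ℕ.≤-refl)) (-y*-comm _)) ⟩
        0# + b                      ≈⟨ +-congˡ (reflexive (monomial-diagonal s b)) ⟨
        0# + monomial s b s         ∎
      coefficient (above j) = begin
        e (suc k) + - y * e k       ≈⟨ +-cong (eFactor-> (ℕ.m<n⇒m<1+n s<k)) (trans (*-congˡ (eFactor-> s<k)) (zeroʳ _)) ⟩
        0# + 0#                     ≈⟨ +-congˡ (monomial-≢ s b (ℕ.m+1+n≢m s)) ⟨
        0# + monomial s b k         ∎
        where
        s<k : s < k
        s<k = ℕ.m<m+n s (s≤s z≤n)

    binomial-⊙-θeFactor : binomial 1 (- y) ⊙ θ e ≋ binomial (suc s) b ⊙ q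
    binomial-⊙-θeFactor zero    =
      trans (binomial-⊙-< 1 (- y) (θ e) (s≤s z≤n)) (sym (binomial-⊙-< (suc s) b q (s≤s z≤n)))
    binomial-⊙-θeFactor (suc k) = trans (binomial-⊙-+ 1 (- y) (θ e) k) (coefficient (position s k))
      where
      coefficient : Position s k → θ e (suc k) + - y * θ e k ≈ (binomial (suc s) b ⊙ q) (suc k)
      coefficient (below k<s) = begin
        (nat· k (e (suc k)) + e (suc k)) + - y * nat· k (e k)
          ≈⟨ +-cong (+-cong (nat·-cong k (eFactor-≤ k<s)) (eFactor-≤ k<s))
                    (*-congˡ (nat·-cong k (eFactor-≤ (ℕ.<⇒≤ k<s)))) ⟩
        (nat· k (pow y k * y) + pow y k * y) + - y * nat· k (pow y k)
          ≈⟨ +-cong (+-congʳ (nat·-*-assoc k _ _)) (-y*-comm _) ⟩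
        (nat· k (pow y k) * y + pow y k * y) + - (nat· k (pow y k) * y)
          ≈⟨ xyx⁻¹≈y _ _ ⟩
        pow y (suc k)
          ≈⟨ qFactor-∤ s y k (λ s+1∣k+1 → ℕ.<⇒≱ (s≤s k<s) (∣⇒≤ s+1∣k+1)) ⟨
        q (suc k)
          ≈⟨ binomial-⊙-< (suc s) b q (s≤s k<s) ⟨
        (binomial (suc s) b ⊙ q) (suc k) ∎
      coefficient at = begin
        (nat· s (e (suc s)) + e (suc s)) + - y * nat· s (e s)
          ≈⟨ +-cong (trans (nat·-cong (suc s) (eFactor-> ℕ.≤-refl)) (nat·-zeroʳ (suc s)))
                    (trans (*-congˡ (nat·-cong s (eFactor-≤ ℕ.≤-refl))) (-y*-comm _)) ⟩
        0# + - (nat· s (pow y s) * y)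
          ≈⟨ trans (+-identityˡ _) (-‿cong (sym (nat·-*-assoc s _ _))) ⟩
        - nat· s (pow y (suc s))
          ≈⟨ qFactor-∣ s y s ∣-refl ⟨
        q (suc s)
          ≈⟨ trans (+-congˡ (zeroʳ b)) (+-identityʳ _) ⟨
        q (suc s) + b * q 0
          ≈⟨ binomial-⊙-diagonal (suc s) b q ⟨
        (binomial (suc s) b ⊙ q) (suc s) ∎
      coefficient (above j) = begin
        (nat· k (e (suc k)) + e (suc k)) + - y * nat· k (e k)
          ≈⟨ +-cong (trans (nat·-cong (suc k) (eFactor-> (ℕ.m<n⇒m<1+n s<k))) (nat·-zeroʳ (suc k)))
                    (trans (*-congˡ (trans (nat·-cong k (eFactor-> s<k)) (nat·-zeroʳ k))) (zeroʳ _)) ⟩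
        0# + 0#
          ≈⟨ +-identityʳ 0# ⟩
        0#
          ≈⟨ -‿inverseʳ _ ⟨
        pow y (suc s) * q (suc j) + - (pow y (suc s) * q (suc j))
          ≈⟨ +-cong (qFactor-periodic s y j) (sym (-‿distribˡ-* _ _)) ⟨
        q (suc s +ℕ suc j) + b * q (suc j)
          ≈⟨ binomial-⊙-+ (suc s) b q (suc j) ⟨
        (binomial (suc s) b ⊙ q) (suc k) ∎
        where
        s<k : s < k
        s<k = ℕ.m<m+n s (s≤s z≤n)

    eFactor-hasLogDerivative : e hasLogDerivative q
    eFactor-hasLogDerivative = ⊙-cancelˡ geometric-⊙-binomial λ k → begin
      (binomial 1 (- y) ⊙ θ e) k          ≈⟨ binomial-⊙-θeFactor k ⟩
      (binomial (suc s) b ⊙ q) k         ≈⟨ ⊙-cong {g = q} binomial-⊙-eFactor (λ _ → refl) k ⟨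
      ((binomial 1 (- y) ⊙ e) ⊙ q) k     ≈⟨ ⊙-assoc _ e q k ⟩
      (binomial 1 (- y) ⊙ (e ⊙ q)) k     ≈⟨ ⊙-cong {f = binomial 1 (- y)} (λ _ → refl) (⊙-comm e q) k ⟩
      (binomial 1 (- y) ⊙ (q ⊙ e)) k     ∎

  eFactor-[-t] : ∀ s y → eFactor s y [-t] ≋ hFactor s y
  eFactor-[-t] s y k with k ≤? s
  ... | yes _ = refl
  ... | no  _ = sign-zero k

module Newton {c ℓ} (R : CommutativeRing c ℓ) (s n : ℕ) (x : Fin n → CommutativeRing.Carrier R) where
  open CommutativeRing R
  open Poly R
  open Scalar R
  open SeriesRing R
  open LogarithmicDerivative R
  open TruncatedGeometricFactor R
  open RingProperties ring

  Eₓ Hₓ Q : Series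
  Eₓ = E s n x
  Hₓ = H s n x
  Q = sumSeries n (λ i → qFactor s (x i))

  Q₀≈0 : Q 0 ≈ 0#
  Q₀≈0 = sumFin-zero n

  P-∣ : ∀ m → suc s ∣ suc m → P s n x (suc m) ≈ sign (suc m) (nat· s (p n x (suc m)))
  P-∣ m s+1∣m+1 with suc s ∣? suc m
  ... | yes _        = refl
  ... | no  s+1∤m+1 = ⊥-elim (s+1∤m+1 s+1∣m+1)

  P-∤ : ∀ m → ¬ (suc s ∣ suc m) → P s n x (suc m) ≈ sign m (p n x (suc m))
  P-∤ m s+1∤m+1 with suc s ∣? suc m
  ... | yes s+1∣m+1 = ⊥-elim (s+1∤m+1 s+1∣m+1)
  ... | no  _        = refl

  P≈sign-Q : ∀ m → P s n x (suc m) ≈ sign m (Q (suc m))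
  P≈sign-Q m = byDivisibility (suc s ∣? suc m)
    where
    open SetoidReasoning setoid
    byDivisibility : Dec (suc s ∣ suc m) → P s n x (suc m) ≈ sign m (Q (suc m))
    byDivisibility (yes s+1∣m+1) = begin
      P s n x (suc m)
        ≈⟨ P-∣ m s+1∣m+1 ⟩
      - sign m (nat· s (p n x (suc m)))
        ≈⟨ sign-neg m _ ⟨
      sign m (- nat· s (p n x (suc m)))
        ≈⟨ sign-cong m (-‿cong (sumFin-nat· n s _)) ⟨
      sign m (- sumFin n (λ i → nat· s (pow (x i) (suc m))))
        ≈⟨ sign-cong m (sumFin-neg n _) ⟨
      sign m (sumFin n (λ i → - nat· s (pow (x i) (suc m))))
        ≈⟨ sign-cong m (sumFin-cong n (λ i → qFactor-∣ s (x i) m s+1∣m+1)) ⟨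
      sign m (Q (suc m)) ∎
    byDivisibility (no s+1∤m+1) =
      trans (P-∤ m s+1∤m+1) (sign-cong m (sym (sumFin-cong n (λ i → qFactor-∤ s (x i) m s+1∤m+1))))

  E-hasLogDerivative : Eₓ hasLogDerivative Q
  E-hasLogDerivative = logDerivative-prodFin n (λ i → eFactor-hasLogDerivative s (x i))

  E[-t]⊙H≋one : Eₓ [-t] ⊙ Hₓ ≋ one
  E[-t]⊙H≋one = begin
    Eₓ [-t] ⊙ Hₓ
      ≈⟨ ⊙-cong (S.trans (prodFin-[-t] n _) (prodFin-cong n (λ i → eFactor-[-t] s (x i)))) S.refl ⟩
    prodFin n (λ i → hFactor s (x i)) ⊙ prodFin n (λ i → inv (hFactor s (x i)))
      ≈⟨ prodFin-⊙ n _ _ ⟨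
    prodFin n (λ i → hFactor s (x i) ⊙ inv (hFactor s (x i)))
      ≈⟨ prodFin-cong n (λ i → inv-inverseʳ (hFactor s (x i)) refl) ⟩
    prodFin n (λ _ → one)
      ≈⟨ prodFin-one n ⟩
    one ∎
    where open SetoidReasoning S.setoid

  H-hasLogDerivative : Hₓ hasLogDerivative -ˢ Q [-t]
  H-hasLogDerivative = logDerivative-inverse E[-t]⊙H≋one (logDerivative-[-t] E-hasLogDerivative)

  -θE[-t]⊙H≋-Q[-t] : (-ˢ θ Eₓ [-t]) ⊙ Hₓ ≋ -ˢ Q [-t]
  -θE[-t]⊙H≋-Q[-t] = begin
    (-ˢ θ Eₓ [-t]) ⊙ Hₓ    ≈⟨ SP.-‿distribˡ-* (θ Eₓ [-t]) Hₓ ⟨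
    -ˢ (θ Eₓ [-t] ⊙ Hₓ)    ≈⟨ S.-‿cong (⊙-cong (θ-[-t] Eₓ) S.refl) ⟨
    -ˢ (θ (Eₓ [-t]) ⊙ Hₓ)  ≈⟨ S.-‿cong (logDerivative≋θ⊙inverse E[-t]⊙H≋one (logDerivative-[-t] E-hasLogDerivative)) ⟨
    -ˢ Q [-t]              ∎
    where
    open SetoidReasoning S.setoid
    module SP = RingProperties S.ring

  newton-E : ∀ k → nat· k (Eₓ k) ≈ sum1 k (λ j → sign (j ∸ 1) (P s n x j * Eₓ (k ∸ j)))
  newton-E k = begin
    θ Eₓ k                            ≈⟨ E-hasLogDerivative k ⟩
    (Q ⊙ Eₓ) k                        ≈⟨ ⊙-coefficient Eₓ k Q₀≈0 ⟩
    sum1 k (λ j → Q j * Eₓ (k ∸ j))   ≈⟨ sum1-cong k term ⟩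
    sum1 k (λ j → sign (j ∸ 1) (P s n x j * Eₓ (k ∸ j))) ∎
    where
    open SetoidReasoning setoid
    term : ∀ j → 1 ≤ j → j ≤ k → Q j * Eₓ (k ∸ j) ≈ sign (j ∸ 1) (P s n x j * Eₓ (k ∸ j))
    term (suc m) _ _ = begin
      Q (suc m) * Eₓ (k ∸ suc m)
        ≈⟨ *-congʳ (trans (sign-cong m (P≈sign-Q m)) (sign-involutive m _)) ⟨
      sign m (P s n x (suc m)) * Eₓ (k ∸ suc m)
        ≈⟨ sign-*-assoc m _ _ ⟨
      sign m (P s n x (suc m) * Eₓ (k ∸ suc m)) ∎

  newton-H : ∀ k → nat· k (Hₓ k) ≈ sum1 k (λ j → P s n x j * Hₓ (k ∸ j))
  newton-H k = begin
    θ Hₓ k                                     ≈⟨ H-hasLogDerivative k ⟩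
    ((-ˢ Q [-t]) ⊙ Hₓ) k                       ≈⟨ ⊙-coefficient Hₓ k (trans (-‿cong Q₀≈0) -0#≈0#) ⟩
    sum1 k (λ j → - sign j (Q j) * Hₓ (k ∸ j)) ≈⟨ sum1-cong k term ⟩
    sum1 k (λ j → P s n x j * Hₓ (k ∸ j))      ∎
    where
    open SetoidReasoning setoid
    term : ∀ j → 1 ≤ j → j ≤ k → - sign j (Q j) * Hₓ (k ∸ j) ≈ P s n x j * Hₓ (k ∸ j)
    term (suc m) _ _ = *-congʳ (trans (-‿involutive _) (sym (P≈sign-Q m)))

  newton-P : ∀ m → P s n x (suc m) ≈
             sum1 (suc m) (λ j → sign (j ∸ 1) (nat· j (Eₓ j * Hₓ (suc m ∸ j))))
  newton-P m = begin
    P s n x (suc m)                         ≈⟨ P≈sign-Q m ⟩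
    sign m (Q (suc m))                      ≈⟨ -‿involutive _ ⟨
    (-ˢ Q [-t]) (suc m)                     ≈⟨ -θE[-t]⊙H≋-Q[-t] (suc m) ⟨
    ((-ˢ θ Eₓ [-t]) ⊙ Hₓ) (suc m)           ≈⟨ ⊙-coefficient Hₓ (suc m) -0#≈0# ⟩
    sum1 (suc m) (λ j → - sign j (nat· j (Eₓ j)) * Hₓ (suc m ∸ j)) ≈⟨ sum1-cong (suc m) term ⟩
    sum1 (suc m) (λ j → sign (j ∸ 1) (nat· j (Eₓ j * Hₓ (suc m ∸ j)))) ∎
    where
    open SetoidReasoning setoid
    term : ∀ j → 1 ≤ j → j ≤ suc m →
           - sign j (nat· j (Eₓ j)) * Hₓ (suc m ∸ j) ≈ sign (j ∸ 1) (nat· j (Eₓ j * Hₓ (suc m ∸ j)))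
    term (suc i) _ _ = begin
      - - sign i (nat· (suc i) (Eₓ (suc i))) * Hₓ (m ∸ i)  ≈⟨ *-congʳ (-‿involutive _) ⟩
      sign i (nat· (suc i) (Eₓ (suc i))) * Hₓ (m ∸ i)      ≈⟨ sign-*-assoc i _ _ ⟨
      sign i (nat· (suc i) (Eₓ (suc i)) * Hₓ (m ∸ i))      ≈⟨ sign-cong i (nat·-*-assoc (suc i) _ _) ⟨
      sign i (nat· (suc i) (Eₓ (suc i) * Hₓ (m ∸ i)))      ∎

open CommutativeRing using (Carrier; _≈_; _*_)
open Poly using (nat·; sign; sum1; E; H; P)

-- The identities hold for all n and s; only the third needs k ≥ 1.

theorem2p3 : ∀ {c ℓ} (R : CommutativeRing c ℓ) (k n s : ℕ) → 1 ≤ k → 1 ≤ n → 1 ≤ s →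
    (x : Fin n → Carrier R) →
    (_≈_ R (nat· R k (E R s n x k))
           (sum1 R k (λ j → sign R (j ∸ 1) (_*_ R (P R s n x j) (E R s n x (k ∸ j))))))
    × (_≈_ R (nat· R k (H R s n x k))
           (sum1 R k (λ j → _*_ R (P R s n x j) (H R s n x (k ∸ j)))))
    × (_≈_ R (P R s n x k)
           (sum1 R k (λ j → sign R (j ∸ 1) (nat· R j (_*_ R (E R s n x j) (H R s n x (k ∸ j)))))))
theorem2p3 R (suc m) n s (s≤s z≤n) _ _ x = newton-E (suc m) , newton-H (suc m) , newton-P m
  where open Newton R s n x
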